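{- Suppose $0<\varepsilon\ll d\ll 1$ and $N$ is a sufficiently large integer (i.e., there is $d_0>0$ such that for every $0<d\le d_0$ there is $\varepsilon_0>0$ such that for every $0<\varepsilon\le\varepsilon_0$ there is $N_0$ such that for every integer $N\ge N_0$ the following holds). If $G(A,B)$ is a complete bipartite graph with partite sets $A,B$ satisfying $(1-\varepsilon-d^2/2)N\le |A|=|B|\le N$, then for any given non-negative integer $\ell\le d^2N$, $G(A,B)$ contains a HIST $T$ with maximum degree $\Delta(T)\le\lceil 2/d^3\rceil$ and $\big||L(T)\cap A|-|L(T)\cap B|\big|=\ell$.
   Context: For a tree $T$, $L(T)$ denotes its set of degree-1 vertices. A HIST of a graph is a spanning tree with no vertex of degree $2$. -}

module Defs where

open import Data.Nat using (ℕ; zero; suc; _+_; _∸_)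
open import Data.Bool using (Bool; true; false; if_then_else_)
open import Data.Fin using (Fin)
import Data.Fin as Fin
open import Data.Sum using (_⊎_; inj₁; inj₂)
open import Data.Product using (Σ; _×_; _,_)
open import Data.Integer using (ℤ; +_)
open import Data.Rational using (ℚ; _÷_; _*_; _<_; 0ℚ; positive; ceiling; _/_)
open import Data.Rational.Properties using (pos⇒nonZero; pos*pos⇒pos)
open import Data.Empty using (⊥)
open import Relation.Binary.PropositionalEquality using (_≡_)

count : {n : ℕ} → (Fin n → Bool) → ℕ
count {zero}  f = 0
count {suc n} f = (if f Fin.zero then 1 else 0) + count (λ i → f (Fin.suc i))

-- The complete bipartite graph K_{n,n} with parts A = B = Fin n.
-- Vertices: inj₁ a (a ∈ A), inj₂ b (b ∈ B).
Vertex : ℕ → Set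
Vertex n = Fin n ⊎ Fin n

-- A spanning subgraph of K_{n,n} is given by its edge set,
-- a (decidable) relation E a b meaning the edge {a,b} (a ∈ A, b ∈ B) is present.
EdgeSet : ℕ → Set
EdgeSet n = Fin n → Fin n → Bool

Adj : {n : ℕ} → EdgeSet n → Vertex n → Vertex n → Set
Adj E (inj₁ a) (inj₁ a′) = ⊥
Adj E (inj₁ a) (inj₂ b)  = E a b ≡ true
Adj E (inj₂ b) (inj₁ a)  = E a b ≡ true
Adj E (inj₂ b) (inj₂ b′) = ⊥

data Reach {n : ℕ} (E : EdgeSet n) : Vertex n → Vertex n → Set where
  here : ∀ {u} → Reach E u u
  step : ∀ {u v w} → Adj E u v → Reach E v w → Reach E u w

Connected : {n : ℕ} → EdgeSet n → Set
Connected {n} E = (u v : Vertex n) → Reach E u v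

deg : {n : ℕ} → EdgeSet n → Vertex n → ℕ
deg E (inj₁ a) = count (λ b → E a b)
deg E (inj₂ b) = count (λ a → E a b)

numEdges : {n : ℕ} → EdgeSet n → ℕ
numEdges {n} E = count′ (λ a → deg E (inj₁ a))
  where
  count′ : {m : ℕ} → (Fin m → ℕ) → ℕ
  count′ {zero}  g = 0
  count′ {suc m} g = g Fin.zero + count′ (λ i → g (Fin.suc i))

IsSpanningTree : {n : ℕ} → EdgeSet n → Set
IsSpanningTree {n} E = Connected E × (numEdges E ≡ (n + n) ∸ 1)

IsHIST : {n : ℕ} → EdgeSet n → Set
IsHIST {n} E = IsSpanningTree E × ((v : Vertex n) → (deg E v ≡ 2 → ⊥))


isLeaf : {n : ℕ} → EdgeSet n → Vertex n → Bool
isLeaf E v with deg E v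
... | 1 = true
... | _ = false

leavesA : {n : ℕ} → EdgeSet n → ℕ
leavesA E = count (λ a → isLeaf E (inj₁ a))

leavesB : {n : ℕ} → EdgeSet n → ℕ
leavesB E = count (λ b → isLeaf E (inj₂ b))

fromℕ : ℕ → ℚ
fromℕ n = (+ n) / 1

ceil2/d³ : (d : ℚ) → 0ℚ < d → ℤ
ceil2/d³ d d>0 = ceiling ((fromℕ 2 ÷ (d * d * d))
                  {{pos⇒nonZero (d * d * d) {{pos*pos⇒pos (d * d) {{pos*pos⇒pos d {{positive d>0}} d {{positive d>0}}}} d {{positive d>0}}}}}})

{-# OPTIONS --safe #-}
module Submission where

-- The tree is grown block by block: each new block, a small HIST, is joined to the
-- tree built so far by a single edge between a non-leaf of each. The result is again
-- a spanning tree, only the two endpoints change degree and neither becomes a leaf or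
-- gets degree 2, so the leaf counts of the two sides simply add up. Double stars on
-- K₃,₃ and K₄,₄ have as many leaves in A as in B, while one HIST of K₅,₅ has one more
-- leaf in B; ℓ copies of the latter followed by double stars covering the remaining
-- n − 5ℓ ≥ 6 vertices of each side give imbalance exactly ℓ with all degrees at most 6.
-- For d ≤ 1/4 and ε ≤ 1/8 the hypotheses give 16ℓ ≤ N ≤ 2n, so N ≥ 32 forces
-- 5ℓ + 6 ≤ n, and 6 d³ ≤ 2 gives ⌈2/d³⌉ ≥ 6.

open import Defs

module HISTs where

  open import Data.Bool using (Bool; true; false; _∧_; if_then_else_)
  open import Data.Bool.Properties using (∧-comm)
  open import Data.Fin using (Fin; zero; suc; _↑ˡ_; _↑ʳ_; splitAt; join)
  open import Data.Fin.Properties using (_≟_; all?; splitAt-↑ˡ; splitAt-↑ʳ; join-splitAt)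
  open import Data.Nat using (ℕ; zero; suc; _+_; _*_; _∸_; ∣_-_∣; _≡ᵇ_; _≤_; _<_; s≤s; _≤?_; _<?_) renaming (_≟_ to _≟ℕ_)
  open import Data.Nat.Properties using (+-assoc; m≤n⇒∃[o]m+o≡n; ∣m-m+n∣≡n; +-identityʳ; +-comm; <⇒≤; +-commutativeSemigroup)
  open import Data.Nat.Tactic.RingSolver using (solve-∀)
  open import Algebra.Properties.CommutativeSemigroup +-commutativeSemigroup using () renaming (interchange to +-interchange)
  open import Data.Product using (Σ; _×_; _,_; proj₁; proj₂)
  open import Data.Sum using (_⊎_; inj₁; inj₂; [_,_])
  open import Function using (_∘_)
  open import Relation.Nullary using (Dec; does; yes; no)
  open import Relation.Nullary.Decidable using (True; toWitness; dec-true; dec-false; map′; ¬?; _×-dec_)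
  open import Relation.Binary.PropositionalEquality using (_≡_; _≢_; refl; sym; trans; cong; cong₂; subst; module ≡-Reasoning)

  count-cong : ∀ {n} {f g : Fin n → Bool} → (∀ i → f i ≡ g i) → count f ≡ count g
  count-cong {zero}  f≗g = refl
  count-cong {suc n} f≗g = cong₂ (λ b c → (if b then 1 else 0) + c) (f≗g zero) (count-cong (f≗g ∘ suc))

  count-false : ∀ n → count {n} (λ _ → false) ≡ 0
  count-false zero    = refl
  count-false (suc n) = count-false n

  count-≟ : ∀ {n} (y : Fin n) → count (λ j → does (j ≟ y)) ≡ 1
  count-≟ {suc n} zero    = cong suc (count-false n)
  count-≟         (suc y) = count-≟ y

  count-↑ : ∀ k {m} (f : Fin (k + m) → Bool) →
            count f ≡ count (λ i → f (i ↑ˡ m)) + count (λ j → f (k ↑ʳ j))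
  count-↑ zero    f = refl
  count-↑ (suc k) f = trans (cong (_+_ b) (count-↑ k (f ∘ suc))) (sym (+-assoc b _ _))
    where b = if f zero then 1 else 0

  ∀-↑ : ∀ k {m} {Q : Fin (k + m) → Set} →
        (∀ i → Q (i ↑ˡ m)) → (∀ j → Q (k ↑ʳ j)) → ∀ i → Q i
  ∀-↑ k {m} {Q} l r i = subst Q (join-splitAt k m i) ([_,_] {C = Q ∘ join k m} l r (splitAt k i))

  isLeaf-deg : ∀ {n} (E : EdgeSet n) v → isLeaf E v ≡ (deg E v ≡ᵇ 1)
  isLeaf-deg E v with deg E v
  ... | 0           = refl
  ... | 1           = refl
  ... | suc (suc _) = refl

  isLeaf-cong : ∀ {n n′} {E : EdgeSet n} {E′ : EdgeSet n′} {v v′} →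
                deg E v ≡ deg E′ v′ → isLeaf E v ≡ isLeaf E′ v′
  isLeaf-cong {E = E} {E′} {v} {v′} eq =
    trans (isLeaf-deg E v) (trans (cong (_≡ᵇ 1) eq) (sym (isLeaf-deg E′ v′)))

  isLeaf-suc : ∀ {n n′} {E : EdgeSet n} {E′ : EdgeSet n′} {v v′} →
               2 ≤ deg E′ v′ → deg E v ≡ suc (deg E′ v′) → isLeaf E v ≡ isLeaf E′ v′
  isLeaf-suc {E = E} {E′} {v} {v′} 2≤d eq =
    trans (isLeaf-deg E v) (trans (cong (_≡ᵇ 1) eq) (trans (both-false 2≤d) (sym (isLeaf-deg E′ v′))))
    where
    both-false : ∀ {d} → 2 ≤ d → (suc d ≡ᵇ 1) ≡ (d ≡ᵇ 1)
    both-false (s≤s (s≤s _)) = refl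

  Adj-sym : ∀ {n} {E : EdgeSet n} u v → Adj E u v → Adj E v u
  Adj-sym (inj₁ a) (inj₂ b) e = e
  Adj-sym (inj₂ b) (inj₁ a) e = e

  Reach-trans : ∀ {n} {E : EdgeSet n} {u v w} → Reach E u v → Reach E v w → Reach E u w
  Reach-trans here       q = q
  Reach-trans (step e p) q = step e (Reach-trans p q)

  Reach-sym : ∀ {n} {E : EdgeSet n} {u v} → Reach E u v → Reach E v u
  Reach-sym here                        = here
  Reach-sym {u = u} (step {v = w} e p) = Reach-trans (Reach-sym p) (step (Adj-sym u w e) here)

  Reach-map : ∀ {n n′} {E : EdgeSet n} {E′ : EdgeSet n′} (f : Vertex n → Vertex n′) →
              (∀ u v → Adj E u v → Adj E′ (f u) (f v)) → ∀ {u v} → Reach E u v → Reach E′ (f u) (f v)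
  Reach-map f adj here                       = here
  Reach-map f adj {u} (step {v = w} e p) = step (adj u w e) (Reach-map f adj p)

  connected-via : ∀ {n} {E : EdgeSet n} (r : Vertex n) → (∀ v → Reach E v r) → Connected E
  connected-via r toRoot u v = Reach-trans (toRoot u) (Reach-sym (toRoot v))

  count-∧-≟ : ∀ {n} c (y : Fin n) → count (λ j → c ∧ does (j ≟ y)) ≡ (if c then 1 else 0)
  count-∧-≟ {n} false y = count-false n
  count-∧-≟     true  y = count-≟ y

  count-≟-∧ : ∀ {n} (x : Fin n) c → count (λ i → does (i ≟ x) ∧ c) ≡ (if c then 1 else 0)
  count-≟-∧ x c = trans (count-cong (λ i → ∧-comm (does (i ≟ x)) c)) (count-∧-≟ c x)

  link : ∀ {k m} → EdgeSet k → Fin k → EdgeSet m → Fin m → EdgeSet (k + m)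
  link {k} {m} P x T y a b = edge (splitAt k a) (splitAt k b)
    where
    edge : Fin k ⊎ Fin m → Fin k ⊎ Fin m → Bool
    edge (inj₁ a) (inj₁ b) = P a b
    edge (inj₁ a) (inj₂ b) = does (a ≟ x) ∧ does (b ≟ y)
    edge (inj₂ a) (inj₁ b) = false
    edge (inj₂ a) (inj₂ b) = T a b

  module Link {k m} (P : EdgeSet k) (x : Fin k) (T : EdgeSet m) (y : Fin m) where

    G : EdgeSet (k + m)
    G = link P x T y

    G-↑ˡ-↑ˡ : ∀ a b → G (a ↑ˡ m) (b ↑ˡ m) ≡ P a b
    G-↑ˡ-↑ˡ a b rewrite splitAt-↑ˡ k a m | splitAt-↑ˡ k b m = refl

    G-↑ˡ-↑ʳ : ∀ a b → G (a ↑ˡ m) (k ↑ʳ b) ≡ does (a ≟ x) ∧ does (b ≟ y)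
    G-↑ˡ-↑ʳ a b rewrite splitAt-↑ˡ k a m | splitAt-↑ʳ k m b = refl

    G-↑ʳ-↑ˡ : ∀ a b → G (k ↑ʳ a) (b ↑ˡ m) ≡ false
    G-↑ʳ-↑ˡ a b rewrite splitAt-↑ʳ k m a | splitAt-↑ˡ k b m = refl

    G-↑ʳ-↑ʳ : ∀ a b → G (k ↑ʳ a) (k ↑ʳ b) ≡ T a b
    G-↑ʳ-↑ʳ a b rewrite splitAt-↑ʳ k m a | splitAt-↑ʳ k m b = refl

    deg-↑ˡ₁ : ∀ a → deg G (inj₁ (a ↑ˡ m)) ≡ deg P (inj₁ a) + (if does (a ≟ x) then 1 else 0)
    deg-↑ˡ₁ a = trans (count-↑ k _)
      (cong₂ _+_ (count-cong (G-↑ˡ-↑ˡ a)) (trans (count-cong (G-↑ˡ-↑ʳ a)) (count-∧-≟ _ y)))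

    deg-↑ˡ₂ : ∀ b → deg G (inj₂ (b ↑ˡ m)) ≡ deg P (inj₂ b)
    deg-↑ˡ₂ b = trans (count-↑ k _)
      (trans (cong₂ _+_ (count-cong (λ a → G-↑ˡ-↑ˡ a b)) (trans (count-cong (λ a → G-↑ʳ-↑ˡ a b)) (count-false m)))
             (+-identityʳ _))

    deg-↑ʳ₁ : ∀ a → deg G (inj₁ (k ↑ʳ a)) ≡ deg T (inj₁ a)
    deg-↑ʳ₁ a = trans (count-↑ k _)
      (cong₂ _+_ (trans (count-cong (G-↑ʳ-↑ˡ a)) (count-false k)) (count-cong (G-↑ʳ-↑ʳ a)))

    deg-↑ʳ₂ : ∀ b → deg G (inj₂ (k ↑ʳ b)) ≡ (if does (b ≟ y) then 1 else 0) + deg T (inj₂ b)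
    deg-↑ʳ₂ b = trans (count-↑ k _)
      (cong₂ _+_ (trans (count-cong (λ a → G-↑ˡ-↑ʳ a b)) (count-≟-∧ x _)) (count-cong (λ a → G-↑ʳ-↑ʳ a b)))

    deg-plug : deg G (inj₁ (x ↑ˡ m)) ≡ suc (deg P (inj₁ x))
    deg-plug = trans (deg-↑ˡ₁ x)
      (trans (cong (λ c → deg P (inj₁ x) + (if c then 1 else 0)) (dec-true (x ≟ x) refl)) (+-comm _ 1))

    deg-socket : deg G (inj₂ (k ↑ʳ y)) ≡ suc (deg T (inj₂ y))
    deg-socket = trans (deg-↑ʳ₂ y) (cong (λ c → (if c then 1 else 0) + deg T (inj₂ y)) (dec-true (y ≟ y) refl))

    left : Vertex k → Vertex (k + m)
    left (inj₁ a) = inj₁ (a ↑ˡ m)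
    left (inj₂ b) = inj₂ (b ↑ˡ m)

    right : Vertex m → Vertex (k + m)
    right (inj₁ a) = inj₁ (k ↑ʳ a)
    right (inj₂ b) = inj₂ (k ↑ʳ b)

    deg-left : ∀ u → deg G (left u) ≡ deg P u ⊎ (u ≡ inj₁ x × deg G (left u) ≡ suc (deg P u))
    deg-left (inj₁ a) with a ≟ x
    ... | yes refl = inj₂ (refl , deg-plug)
    ... | no a≢x   = inj₁ (trans (deg-↑ˡ₁ a)
                            (trans (cong (λ c → deg P (inj₁ a) + (if c then 1 else 0)) (dec-false (a ≟ x) a≢x))
                                   (+-identityʳ _)))
    deg-left (inj₂ b) = inj₁ (deg-↑ˡ₂ b)

    deg-right : ∀ u → deg G (right u) ≡ deg T u ⊎ (u ≡ inj₂ y × deg G (right u) ≡ suc (deg T u))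
    deg-right (inj₁ a) = inj₁ (deg-↑ʳ₁ a)
    deg-right (inj₂ b) with b ≟ y
    ... | yes refl = inj₂ (refl , deg-socket)
    ... | no b≢y   = inj₁ (trans (deg-↑ʳ₂ b) (cong (λ c → (if c then 1 else 0) + deg T (inj₂ b)) (dec-false (b ≟ y) b≢y)))

    ∀-vertex : {Q : Vertex (k + m) → Set} → (∀ u → Q (left u)) → (∀ u → Q (right u)) → ∀ w → Q w
    ∀-vertex {Q} l r (inj₁ i) = ∀-↑ k {Q = Q ∘ inj₁} (l ∘ inj₁) (r ∘ inj₁) i
    ∀-vertex {Q} l r (inj₂ i) = ∀-↑ k {Q = Q ∘ inj₂} (l ∘ inj₂) (r ∘ inj₂) i

    ∀-deg : (Q : ℕ → Set) → (∀ u → Q (deg P u)) → (∀ u → Q (deg T u)) →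
            Q (suc (deg P (inj₁ x))) → Q (suc (deg T (inj₂ y))) → ∀ w → Q (deg G w)
    ∀-deg Q qP qT qx qy = ∀-vertex fromLeft fromRight
      where
      fromLeft : ∀ u → Q (deg G (left u))
      fromLeft u with deg-left u
      ... | inj₁ eq          = subst Q (sym eq) (qP u)
      ... | inj₂ (refl , eq) = subst Q (sym eq) qx
      fromRight : ∀ u → Q (deg G (right u))
      fromRight u with deg-right u
      ... | inj₁ eq          = subst Q (sym eq) (qT u)
      ... | inj₂ (refl , eq) = subst Q (sym eq) qy

    isLeaf-left : 2 ≤ deg P (inj₁ x) → ∀ u → isLeaf G (left u) ≡ isLeaf P u
    isLeaf-left 2≤d u with deg-left u
    ... | inj₁ eq          = isLeaf-cong {E = G} {P} {left u} {u} eq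
    ... | inj₂ (refl , eq) = isLeaf-suc {E = G} {P} {left u} {u} 2≤d eq

    isLeaf-right : 2 ≤ deg T (inj₂ y) → ∀ u → isLeaf G (right u) ≡ isLeaf T u
    isLeaf-right 2≤d u with deg-right u
    ... | inj₁ eq          = isLeaf-cong {E = G} {T} {right u} {u} eq
    ... | inj₂ (refl , eq) = isLeaf-suc {E = G} {T} {right u} {u} 2≤d eq

    module _ (2≤dx : 2 ≤ deg P (inj₁ x)) (2≤dy : 2 ≤ deg T (inj₂ y)) where

      leavesA-link : leavesA G ≡ leavesA P + leavesA T
      leavesA-link = trans (count-↑ k _)
        (cong₂ _+_ (count-cong (isLeaf-left 2≤dx ∘ inj₁)) (count-cong (isLeaf-right 2≤dy ∘ inj₁)))

      leavesB-link : leavesB G ≡ leavesB P + leavesB T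
      leavesB-link = trans (count-↑ k _)
        (cong₂ _+_ (count-cong (isLeaf-left 2≤dx ∘ inj₂)) (count-cong (isLeaf-right 2≤dy ∘ inj₂)))

    Adj-left : ∀ u v → Adj P u v → Adj G (left u) (left v)
    Adj-left (inj₁ a) (inj₂ b) e = trans (G-↑ˡ-↑ˡ a b) e
    Adj-left (inj₂ b) (inj₁ a) e = trans (G-↑ˡ-↑ˡ a b) e

    Adj-right : ∀ u v → Adj T u v → Adj G (right u) (right v)
    Adj-right (inj₁ a) (inj₂ b) e = trans (G-↑ʳ-↑ʳ a b) e
    Adj-right (inj₂ b) (inj₁ a) e = trans (G-↑ʳ-↑ʳ a b) e

    Adj-bridge : Adj G (right (inj₂ y)) (left (inj₁ x))
    Adj-bridge = trans (G-↑ˡ-↑ʳ x y) (cong₂ _∧_ (dec-true (x ≟ x) refl) (dec-true (y ≟ y) refl))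

    connected-link : Connected P → Connected T → Connected G
    connected-link conP conT = connected-via (left (inj₁ x)) (∀-vertex fromLeft fromRight)
      where
      fromLeft : ∀ u → Reach G (left u) (left (inj₁ x))
      fromLeft u = Reach-map left Adj-left (conP u (inj₁ x))
      fromRight : ∀ u → Reach G (right u) (left (inj₁ x))
      fromRight u = Reach-trans (Reach-map right Adj-right (conT u (inj₂ y))) (step Adj-bridge here)

  spanning-edges : ∀ {k m} → Fin k → Fin m → (k + k ∸ 1) + suc (m + m ∸ 1) ≡ (k + m) + (k + m) ∸ 1
  spanning-edges {suc k} {suc m} _ _ = lemma k m
    where
    lemma : ∀ k m → (k + suc k) + suc (m + suc m) ≡ (k + suc m) + suc (k + suc m)
    lemma = solve-∀

  3≤⇒suc≢2 : ∀ {d} → 3 ≤ d → suc d ≢ 2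
  3≤⇒suc≢2 (s≤s (s≤s (s≤s _))) ()

  record Socketed (Δ ℓ n : ℕ) : Set where
    field
      tree      : EdgeSet n
      isHIST    : IsHIST tree
      deg≤      : ∀ v → deg tree v ≤ Δ
      balance   : leavesB tree ≡ leavesA tree + ℓ
      socket    : Fin n
      socket-3≤ : 3 ≤ deg tree (inj₂ socket)
      socket<Δ  : deg tree (inj₂ socket) < Δ

  record Block (Δ ℓ k : ℕ) : Set where
    field
      base     : Socketed Δ ℓ k
    open Socketed base using (tree)
    -- numEdges sums the rows through a helper local to Defs, so it unfolds only for a
    -- concrete number of rows; additivity under link is therefore proved block by block.
    field
      plug     : Fin k
      plug-3≤  : 3 ≤ deg tree (inj₁ plug)
      plug<Δ   : deg tree (inj₁ plug) < Δ
      numEdges-link : ∀ {m} (T : EdgeSet m) y → numEdges (link tree plug T y) ≡ numEdges tree + suc (numEdges T)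

  infixr 5 _⊕_
  _⊕_ : ∀ {Δ ℓ₁ ℓ₂ k m} → Block Δ ℓ₁ k → Socketed Δ ℓ₂ m → Socketed Δ (ℓ₁ + ℓ₂) (k + m)
  _⊕_ {Δ} {ℓ₁} {ℓ₂} {k} {m} B S = record
    { tree      = G
    ; isHIST    = (connected-link (proj₁ (proj₁ P.isHIST)) (proj₁ (proj₁ S.isHIST)) , edges)
                , ∀-deg (_≢ 2) (proj₂ P.isHIST) (proj₂ S.isHIST) (3≤⇒suc≢2 B.plug-3≤) (3≤⇒suc≢2 S.socket-3≤)
    ; deg≤      = ∀-deg (_≤ Δ) P.deg≤ S.deg≤ B.plug<Δ S.socket<Δ
    ; balance   = balance
    ; socket    = P.socket ↑ˡ m
    ; socket-3≤ = subst (3 ≤_) (sym (deg-↑ˡ₂ P.socket)) P.socket-3≤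
    ; socket<Δ  = subst (_< Δ) (sym (deg-↑ˡ₂ P.socket)) P.socket<Δ
    }
    where
    module B = Block B
    module P = Socketed B.base
    module S = Socketed S
    open Link P.tree B.plug S.tree S.socket

    edges : numEdges G ≡ (k + m) + (k + m) ∸ 1
    edges = begin
      numEdges G                                ≡⟨ B.numEdges-link S.tree S.socket ⟩
      numEdges P.tree + suc (numEdges S.tree)   ≡⟨ cong₂ (λ p s → p + suc s) (proj₂ (proj₁ P.isHIST)) (proj₂ (proj₁ S.isHIST)) ⟩
      (k + k ∸ 1) + suc (m + m ∸ 1)             ≡⟨ spanning-edges P.socket S.socket ⟩
      (k + m) + (k + m) ∸ 1                     ∎
      where open ≡-Reasoning

    balance : leavesB G ≡ leavesA G + (ℓ₁ + ℓ₂)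
    balance = begin
      leavesB G                                            ≡⟨ leavesB-link (<⇒≤ B.plug-3≤) (<⇒≤ S.socket-3≤) ⟩
      leavesB P.tree + leavesB S.tree                      ≡⟨ cong₂ _+_ P.balance S.balance ⟩
      (leavesA P.tree + ℓ₁) + (leavesA S.tree + ℓ₂)        ≡⟨ +-interchange (leavesA P.tree) ℓ₁ _ ℓ₂ ⟩
      (leavesA P.tree + leavesA S.tree) + (ℓ₁ + ℓ₂)        ≡⟨ cong (_+ (ℓ₁ + ℓ₂)) (leavesA-link (<⇒≤ B.plug-3≤) (<⇒≤ S.socket-3≤)) ⟨
      leavesA G + (ℓ₁ + ℓ₂)                                ∎
      where open ≡-Reasoning

  vertices? : ∀ {n} {Q : Vertex n → Set} → (∀ v → Dec (Q v)) → Dec (∀ v → Q v)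
  vertices? Q? = map′ (λ (l , r) → [ l , r ]) (λ q → q ∘ inj₁ , q ∘ inj₂) (all? (Q? ∘ inj₁) ×-dec all? (Q? ∘ inj₂))

  doubleStar : ∀ {n} → EdgeSet n
  doubleStar zero    _       = true
  doubleStar (suc _) zero    = true
  doubleStar (suc _) (suc _) = false

  doubleStar-toHub : ∀ {n} v → Reach (doubleStar {suc n}) v (inj₂ zero)
  doubleStar-toHub (inj₁ zero)    = step refl here
  doubleStar-toHub (inj₁ (suc a)) = step refl here
  doubleStar-toHub (inj₂ zero)    = here
  doubleStar-toHub (inj₂ (suc b)) = step {v = inj₁ zero} refl (step refl here)

  skewTree : EdgeSet 5
  skewTree _          zero                = true
  skewTree zero       (suc zero)          = true
  skewTree zero       (suc (suc zero))    = true
  skewTree (suc zero) (suc (suc (suc _))) = true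
  skewTree _          _                   = false

  skewTree-toHub : ∀ v → Reach skewTree v (inj₂ zero)
  skewTree-toHub (inj₁ a)                   = step refl here
  skewTree-toHub (inj₂ zero)                = here
  skewTree-toHub (inj₂ (suc zero))          = step {v = inj₁ zero} refl (step refl here)
  skewTree-toHub (inj₂ (suc (suc zero)))    = step {v = inj₁ zero} refl (step refl here)
  skewTree-toHub (inj₂ (suc (suc (suc b)))) = step {v = inj₁ (suc zero)} refl (step refl here)

  block : ∀ {Δ ℓ k} (P : EdgeSet (suc k)) → (∀ v → Reach P v (inj₂ zero)) →
          (∀ {m} (T : EdgeSet m) y → numEdges (link P zero T y) ≡ numEdges P + suc (numEdges T)) →
          {_ : True (numEdges P ≟ℕ (suc k + suc k) ∸ 1)} →
          {_ : True (vertices? λ v → ¬? (deg P v ≟ℕ 2))} →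
          {_ : True (vertices? λ v → deg P v ≤? Δ)} →
          {_ : True (leavesB P ≟ℕ leavesA P + ℓ)} →
          {_ : True (3 ≤? deg P (inj₂ zero))} → {_ : True (deg P (inj₂ zero) <? Δ)} →
          {_ : True (3 ≤? deg P (inj₁ zero))} → {_ : True (deg P (inj₁ zero) <? Δ)} →
          Block Δ ℓ (suc k)
  block P toHub numEdges-link {edges} {no-2} {deg≤} {balance} {s-3≤} {s<Δ} {p-3≤} {p<Δ} = record
    { base          = record
      { tree      = P
      ; isHIST    = (connected-via (inj₂ zero) toHub , toWitness edges) , toWitness no-2
      ; deg≤      = toWitness deg≤
      ; balance   = toWitness balance
      ; socket    = zero
      ; socket-3≤ = toWitness s-3≤
      ; socket<Δ  = toWitness s<Δ
      }
    ; plug          = zero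
    ; plug-3≤       = toWitness p-3≤
    ; plug<Δ        = toWitness p<Δ
    ; numEdges-link = numEdges-link
    }

  small : Block 6 0 3
  small = block doubleStar doubleStar-toHub
    λ {m} T y → cong₂ (λ c z → 3 + (c + suc (z + suc (z + numEdges T)))) (count-≟ y) (count-false m)

  medium : Block 6 0 4
  medium = block doubleStar doubleStar-toHub
    λ {m} T y → cong₂ (λ c z → 4 + (c + suc (z + suc (z + suc (z + numEdges T))))) (count-≟ y) (count-false m)

  skew : Block 6 1 5
  skew = block skewTree skewTree-toHub
    λ {m} T y → cong₂ (λ c z → 3 + (c + (3 + (z + suc (z + suc (z + suc (z + numEdges T))))))) (count-≟ y) (count-false m)

  balanced : ∀ q → Socketed 6 0 (6 + q)
  balanced 0                   = small ⊕ Block.base small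
  balanced 1                   = small ⊕ Block.base medium
  balanced 2                   = medium ⊕ Block.base medium
  balanced (suc (suc (suc q))) = small ⊕ balanced q

  skewed : ∀ ℓ q → Socketed 6 ℓ (ℓ * 5 + (6 + q))
  skewed zero    q = balanced q
  skewed (suc ℓ) q = skew ⊕ skewed ℓ q

  HIST-with-imbalance : ∀ n ℓ → ℓ * 5 + 6 ≤ n →
    Σ (EdgeSet n) λ T → IsHIST T × (∀ v → deg T v ≤ 6) × ∣ leavesA T - leavesB T ∣ ≡ ℓ
  HIST-with-imbalance n ℓ h with q , refl ← m≤n⇒∃[o]m+o≡n h rewrite +-assoc (ℓ * 5) 6 q =
    tree , isHIST , deg≤ , trans (cong (∣ leavesA tree -_∣) balance) (∣m-m+n∣≡n (leavesA tree) ℓ)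
    where open Socketed (skewed ℓ q)

module Bounds where
  open import Data.Integer using (+_; -_)
  import Data.Integer as ℤ
  import Data.Integer.Properties as ℤ
  open import Data.Integer.DivMod using ([n/d]*d≤n)
  open import Data.Nat using (ℕ)
  import Data.Nat as ℕ
  import Data.Nat.Properties as ℕ
  import Data.Nat.Coprimality as Coprime
  open import Data.Nat.Tactic.RingSolver using (solve-∀)
  import Data.Rational as ℚ
  open import Data.Rational using (ℚ; mkℚ; ↥_; ↧_; floor; ceiling; *≤*; 0ℚ; 1ℚ; _<_; _≤_; _*_; _-_; _÷_; 1/_; NonNegative; Positive; positive; _/_)
  open import Data.Rational.Properties
    using (normalize-coprime; drop-*≤*; ↥-neg; ↧-neg; neg-antimono-≤; pos⇒nonNeg; pos⇒nonZero; 1/pos⇒pos; nonNeg*nonNeg⇒nonNeg; pos*pos⇒pos;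
           *-monoˡ-≤-nonNeg; *-monoʳ-≤-nonNeg; *-assoc; *-identityˡ; *-identityʳ; *-inverseʳ; +-mono-≤; +-monoʳ-≤; ≤-trans; _≤?_; _<?_; module ≤-Reasoning)
  open import Relation.Binary.PropositionalEquality using (_≡_; sym; trans; cong; subst₂)
  open import Relation.Nullary.Decidable using (from-yes)

  fromℕ-mkℚ : ∀ n → fromℕ n ≡ mkℚ (+ n) 0 (Coprime.sym (Coprime.1-coprimeTo n))
  fromℕ-mkℚ n = normalize-coprime (Coprime.sym (Coprime.1-coprimeTo n))

  fromℕ-nonNeg : ∀ n → NonNegative (fromℕ n)
  fromℕ-nonNeg n rewrite fromℕ-mkℚ n = _

  fromℕ-cancel-≤ : ∀ {a b} → fromℕ a ≤ fromℕ b → a ℕ.≤ b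
  fromℕ-cancel-≤ {a} {b} a≤b rewrite fromℕ-mkℚ a | fromℕ-mkℚ b with *≤* a*1≤b*1 ← a≤b =
    ℤ.drop‿+≤+ (subst₂ ℤ._≤_ (ℤ.*-identityʳ (+ a)) (ℤ.*-identityʳ (+ b)) a*1≤b*1)

  fromℕ-* : ∀ a b → fromℕ a * fromℕ b ≡ fromℕ (a ℕ.* b)
  fromℕ-* a b rewrite fromℕ-mkℚ a | fromℕ-mkℚ b = cong (_/ 1) (sym (ℤ.pos-* a b))

  module _ (c : ℕ) (q : ℚ) (a b : ℕ) where
    open ≤-Reasoning

    scale-≤ : fromℕ a ≤ q * fromℕ b → fromℕ c * q ≤ 1ℚ → c ℕ.* a ℕ.≤ b
    scale-≤ a≤qb cq≤1 = fromℕ-cancel-≤ (begin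
      fromℕ (c ℕ.* a)           ≡⟨ fromℕ-* c a ⟨
      fromℕ c * fromℕ a         ≤⟨ *-monoˡ-≤-nonNeg (fromℕ c) {{fromℕ-nonNeg c}} a≤qb ⟩
      fromℕ c * (q * fromℕ b)   ≡⟨ *-assoc (fromℕ c) q (fromℕ b) ⟨
      fromℕ c * q * fromℕ b     ≤⟨ *-monoʳ-≤-nonNeg (fromℕ b) {{fromℕ-nonNeg b}} cq≤1 ⟩
      1ℚ * fromℕ b              ≡⟨ *-identityˡ (fromℕ b) ⟩
      fromℕ b                   ∎)

    scale-≥ : q * fromℕ b ≤ fromℕ a → 1ℚ ≤ fromℕ c * q → b ℕ.≤ c ℕ.* a
    scale-≥ qb≤a 1≤cq = fromℕ-cancel-≤ (begin
      fromℕ b                   ≡⟨ *-identityˡ (fromℕ b) ⟨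
      1ℚ * fromℕ b              ≤⟨ *-monoʳ-≤-nonNeg (fromℕ b) {{fromℕ-nonNeg b}} 1≤cq ⟩
      fromℕ c * q * fromℕ b     ≡⟨ *-assoc (fromℕ c) q (fromℕ b) ⟩
      fromℕ c * (q * fromℕ b)   ≤⟨ *-monoˡ-≤-nonNeg (fromℕ c) {{fromℕ-nonNeg c}} qb≤a ⟩
      fromℕ c * fromℕ a         ≡⟨ fromℕ-* c a ⟩
      fromℕ (c ℕ.* a)           ∎)

  ≤-÷ : ∀ {c q} p .{{_ : Positive p}} → c * p ≤ q → c ≤ (q ÷ p) {{pos⇒nonZero p}}
  ≤-÷ {c} {q} p cp≤q = begin
    c                                       ≡⟨ *-identityʳ c ⟨
    c * 1ℚ                                  ≡⟨ cong (c *_) (*-inverseʳ p {{pos⇒nonZero p}}) ⟨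
    c * (p * (1/ p) {{pos⇒nonZero p}})      ≡⟨ *-assoc c p _ ⟨
    c * p * (1/ p) {{pos⇒nonZero p}}        ≤⟨ *-monoʳ-≤-nonNeg ((1/ p) {{pos⇒nonZero p}}) {{pos⇒nonNeg ((1/ p) {{pos⇒nonZero p}}) {{1/pos⇒pos p}}}} cp≤q ⟩
    q * (1/ p) {{pos⇒nonZero p}}            ∎
    where open ≤-Reasoning

  floor≤-fromℕ : ∀ c r → r ≤ ℚ.- fromℕ c → floor r ℤ.≤ - + c
  floor≤-fromℕ c r@(mkℚ n _ _) r≤-c = ℤ.*-cancelʳ-≤-pos (floor r) (- + c) (↧ r) (begin
    floor r ℤ.* ↧ r   ≤⟨ [n/d]*d≤n n (↧ r) ⟩
    n                 ≡⟨ ℤ.*-identityʳ n ⟨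
    n ℤ.* + 1         ≤⟨ subst₂ (λ a b → n ℤ.* a ℤ.≤ b ℤ.* ↧ r) ↧-c ↥-c (drop-*≤* r≤-c) ⟩
    - + c ℤ.* ↧ r     ∎)
    where
    open ℤ.≤-Reasoning
    ↥-c : ↥ (ℚ.- fromℕ c) ≡ - + c
    ↥-c = trans (↥-neg (fromℕ c)) (cong (λ p → - ↥ p) (fromℕ-mkℚ c))
    ↧-c : ↧ (ℚ.- fromℕ c) ≡ + 1
    ↧-c = trans (↧-neg (fromℕ c)) (cong ↧_ (fromℕ-mkℚ c))

  fromℕ≤⇒≤ceiling : ∀ c q → fromℕ c ≤ q → + c ℤ.≤ ceiling q
  fromℕ≤⇒≤ceiling c q@(mkℚ _ _ _) c≤q = begin
    + c                 ≡⟨ ℤ.neg-involutive (+ c) ⟨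
    - - + c             ≤⟨ ℤ.neg-mono-≤ (floor≤-fromℕ c (ℚ.- q) (neg-antimono-≤ c≤q)) ⟩
    ceiling q           ∎
    where open ℤ.≤-Reasoning

  ¼ ⅛ : ℚ
  ¼ = + 1 / 4
  ⅛ = + 1 / 8

  0<¼ : 0ℚ < ¼
  0<¼ = from-yes (0ℚ <? ¼)

  0<⅛ : 0ℚ < ⅛
  0<⅛ = from-yes (0ℚ <? ⅛)

  size-bound : ∀ {N n ℓ} → 32 ℕ.≤ N → N ℕ.≤ 2 ℕ.* n → 16 ℕ.* ℓ ℕ.≤ N → ℓ ℕ.* 5 ℕ.+ 6 ℕ.≤ n
  size-bound {N} {n} {ℓ} 32≤N N≤2n 16ℓ≤N = ℕ.*-cancelˡ-≤ 16 (begin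
    16 ℕ.* (ℓ ℕ.* 5 ℕ.+ 6)            ≡⟨ expand ℓ ⟩
    5 ℕ.* (16 ℕ.* ℓ) ℕ.+ 3 ℕ.* 32     ≤⟨ ℕ.+-mono-≤ (ℕ.*-monoʳ-≤ 5 16ℓ≤N) (ℕ.*-monoʳ-≤ 3 32≤N) ⟩
    5 ℕ.* N ℕ.+ 3 ℕ.* N               ≡⟨ collect N ⟩
    8 ℕ.* N                           ≤⟨ ℕ.*-monoʳ-≤ 8 N≤2n ⟩
    8 ℕ.* (2 ℕ.* n)                   ≡⟨ ℕ.*-assoc 8 2 n ⟨
    16 ℕ.* n                          ∎)
    where
    open ℕ.≤-Reasoning
    expand : ∀ ℓ → 16 ℕ.* (ℓ ℕ.* 5 ℕ.+ 6) ≡ 5 ℕ.* (16 ℕ.* ℓ) ℕ.+ 3 ℕ.* 32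
    expand = solve-∀
    collect : ∀ N → 5 ℕ.* N ℕ.+ 3 ℕ.* N ≡ 8 ℕ.* N
    collect = solve-∀

  module _ {d : ℚ} (d>0 : 0ℚ < d) (d≤¼ : d ≤ ¼) where
    instance
      d-pos : Positive d
      d-pos = positive d>0
      d-nonNeg : NonNegative d
      d-nonNeg = pos⇒nonNeg d
      d²-nonNeg : NonNegative (d * d)
      d²-nonNeg = nonNeg*nonNeg⇒nonNeg d d
      d³-pos : Positive (d * d * d)
      d³-pos = pos*pos⇒pos (d * d) {{pos*pos⇒pos d d}} d

    d²≤ : d * d ≤ ¼ * ¼
    d²≤ = ≤-trans (*-monoʳ-≤-nonNeg d d≤¼) (*-monoˡ-≤-nonNeg ¼ d≤¼)

    16d²≤1 : fromℕ 16 * (d * d) ≤ 1ℚ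
    16d²≤1 = *-monoˡ-≤-nonNeg (fromℕ 16) d²≤

    ≤⌈2/d³⌉ : ∀ {k} → k ℕ.≤ 6 → + k ℤ.≤ ceil2/d³ d d>0
    ≤⌈2/d³⌉ k≤6 = ℤ.≤-trans (ℤ.+≤+ k≤6) (fromℕ≤⇒≤ceiling 6 _ (≤-÷ (d * d * d) 6d³≤2))
      where
      d³≤ : d * d * d ≤ ¼ * ¼ * ¼
      d³≤ = ≤-trans (*-monoʳ-≤-nonNeg d d²≤) (*-monoˡ-≤-nonNeg (¼ * ¼) d≤¼)
      6d³≤2 : fromℕ 6 * (d * d * d) ≤ fromℕ 2
      6d³≤2 = ≤-trans (*-monoˡ-≤-nonNeg (fromℕ 6) d³≤) (from-yes (fromℕ 6 * (¼ * ¼ * ¼) ≤? fromℕ 2))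

    1≤2[1-ε-d²/2] : ∀ {ε} → ε ≤ ⅛ → 1ℚ ≤ fromℕ 2 * (1ℚ - ε - (d * d) ÷ fromℕ 2)
    1≤2[1-ε-d²/2] ε≤⅛ = ≤-trans (from-yes (1ℚ ≤? fromℕ 2 * (1ℚ - ⅛ - (¼ * ¼) ÷ fromℕ 2)))
      (*-monoˡ-≤-nonNeg (fromℕ 2) (+-mono-≤ (+-monoʳ-≤ 1ℚ (neg-antimono-≤ ε≤⅛)) (neg-antimono-≤ (*-monoʳ-≤-nonNeg _ d²≤))))

    enough-vertices : ∀ {ε} → ε ≤ ⅛ → ∀ N n ℓ → 32 ℕ.≤ N →
                      (1ℚ - ε - (d * d) ÷ fromℕ 2) * fromℕ N ≤ fromℕ n → fromℕ ℓ ≤ d * d * fromℕ N →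
                      ℓ ℕ.* 5 ℕ.+ 6 ℕ.≤ n
    enough-vertices {ε} ε≤⅛ N n ℓ 32≤N dense sparse = size-bound {ℓ = ℓ} 32≤N
      (scale-≥ 2 (1ℚ - ε - (d * d) ÷ fromℕ 2) n N dense (1≤2[1-ε-d²/2] ε≤⅛))
      (scale-≤ 16 (d * d) ℓ N sparse 16d²≤1)

open import Data.Nat using (ℕ; _≥_; ∣_-_∣)
import Data.Nat as ℕ
open import Data.Integer using (+_)
import Data.Integer as ℤ
open import Data.Rational using (ℚ; 0ℚ; 1ℚ; _<_; _≤_; _*_; _-_; _÷_)
open import Data.Product using (Σ; _×_; _,_)
open import Relation.Binary.PropositionalEquality using (_≡_)

open HISTs using (HIST-with-imbalance)
open Bounds using (¼; ⅛; 0<¼; 0<⅛; ≤⌈2/d³⌉; enough-vertices)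

lemma4p4 :
    Σ ℚ λ d₀ → 0ℚ < d₀ ×
    ((d : ℚ) → (d>0 : 0ℚ < d) → d ≤ d₀ →
      Σ ℚ λ ε₀ → 0ℚ < ε₀ ×
      ((ε : ℚ) → 0ℚ < ε → ε ≤ ε₀ →
        Σ ℕ λ N₀ →
        ((N : ℕ) → N ≥ N₀ →
          (n : ℕ) →
          (1ℚ - ε - (d * d) ÷ fromℕ 2) * fromℕ N ≤ fromℕ n →
          n ℕ.≤ N →
          (ℓ : ℕ) → fromℕ ℓ ≤ d * d * fromℕ N →
          Σ (EdgeSet n) λ T →
            IsHIST T ×
            ((v : Vertex n) → + deg T v ℤ.≤ ceil2/d³ d d>0) ×
            (∣ leavesA T - leavesB T ∣ ≡ ℓ))))
lemma4p4 = ¼ , 0<¼ , λ d d>0 d≤¼ → ⅛ , 0<⅛ , λ ε _ ε≤⅛ → 32 , λ N 32≤N n dense _ ℓ sparse →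
  let T , hist , deg≤6 , imbalance = HIST-with-imbalance n ℓ (enough-vertices d>0 d≤¼ ε≤⅛ N n ℓ 32≤N dense sparse)
  in T , hist , (λ v → ≤⌈2/d³⌉ d>0 d≤¼ (deg≤6 v)) , imbalance
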